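{- Let $G$ be a finite simple connected graph with $n$ vertices and $m$ edges, and let $pG$ denote the join of $p$ vertex-disjoint copies of $G$ (the union of the $p$ copies together with all edges joining vertices in different copies). Then \[F(pG)=pF(G)+3np(p-1)M_1(G)+6n^2mp(p-1)^2+n^4p(p-1)^3.\]
   Context: For a finite simple graph $G$ with vertex degrees $d_G(v)$: $M_1(G)=\sum_{v\in V(G)} d_G(v)^2$ (first Zagreb index) and $F(G)=\sum_{v\in V(G)} d_G(v)^3$ (F-index). -}

module Defs where

open import Data.Nat using (ℕ; _+_; _*_; _<_)
open import Data.Bool using (Bool; true; false; if_then_else_)
open import Data.Fin using (Fin; toℕ; quotient; remainder; _≟_)
open import Data.List using (List; map; allFin)
open import Data.Nat.ListAction using (sum)
open import Relation.Nullary using (yes; no)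
open import Relation.Nullary.Decidable using (⌊_⌋)
open import Relation.Binary.PropositionalEquality using (_≡_; refl; sym; trans)

record Graph (n : ℕ) : Set where
  field
    adj   : Fin n → Fin n → Bool
    symm  : ∀ u v → adj u v ≡ adj v u
    loopless : ∀ v → adj v v ≡ false
open Graph public

Σv : ∀ {n} → (Fin n → ℕ) → ℕ
Σv {n} f = sum (map f (allFin n))

χ : Bool → ℕ
χ true  = 1
χ false = 0

degree : ∀ {n} → Graph n → Fin n → ℕ
degree G v = Σv (λ u → χ (adj G v u))

edgeCount : ∀ {n} → Graph n → ℕ
edgeCount G = Σv (λ u → Σv (λ v → χ (⌊ Data.Nat._<?_ (toℕ u) (toℕ v) ⌋ Data.Bool.∧ adj G u v)))

M₁ : ∀ {n} → Graph n → ℕ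
M₁ G = Σv (λ v → degree G v * degree G v)

Findex : ∀ {n} → Graph n → ℕ
Findex G = Σv (λ v → degree G v * degree G v * degree G v)

data Reach {n} (G : Graph n) : Fin n → Fin n → Set where
  here : ∀ {v} → Reach G v v
  step : ∀ {u w v} → adj G u w ≡ true → Reach G w v → Reach G u v

Connected : ∀ {n} → Graph n → Set
Connected {n} G = ∀ (u v : Fin n) → Reach G u v

-- join of p vertex-disjoint copies of G.  Vertex i : Fin (p * n) is the
-- vertex (remainder n i) of copy (quotient n i).
copyOf : ∀ {n} (p : ℕ) → Fin (p * n) → Fin p
copyOf {n} p i = quotient {p} n i

vertexOf : ∀ {n} (p : ℕ) → Fin (p * n) → Fin n
vertexOf {n} p i = remainder {p} n i

joinAdj : ∀ {n} (p : ℕ) → Graph n → Fin (p * n) → Fin (p * n) → Bool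
joinAdj {n} p G i j with copyOf p i ≟ copyOf p j
... | yes _ = adj G (vertexOf p i) (vertexOf p j)
... | no  _ = true

private
  joinSym : ∀ {n} (p : ℕ) (G : Graph n) i j → joinAdj p G i j ≡ joinAdj p G j i
  joinSym {n} p G i j with copyOf {n} p i ≟ copyOf p j | copyOf {n} p j ≟ copyOf p i
  ... | yes _ | yes _ = symm G _ _
  ... | yes e | no ne = Data.Empty.⊥-elim (ne (sym e))
    where import Data.Empty
  ... | no ne | yes e = Data.Empty.⊥-elim (ne (sym e))
    where import Data.Empty
  ... | no _  | no _  = refl

  joinLoop : ∀ {n} (p : ℕ) (G : Graph n) i → joinAdj p G i i ≡ false
  joinLoop {n} p G i with copyOf {n} p i ≟ copyOf p i
  ... | yes _ = loopless G _
  ... | no ne = Data.Empty.⊥-elim (ne refl)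
    where import Data.Empty

joinCopies : ∀ {n} (p : ℕ) → Graph n → Graph (p * n)
joinCopies p G = record { adj = joinAdj p G ; symm = joinSym p G ; loopless = joinLoop p G }

module Submission where

-- A vertex of pG is a pair (a , b) of a copy a and a vertex b of G.  Its
-- neighbours are the G-neighbours of b inside copy a together with all
-- n(p-1) vertices of the other copies, so its degree is d(b) + k with
-- k = (p-1)n.  Hence F(pG) = p · Σ_b (d(b) + k)³, and expanding the cube
--   Σ_b (d(b) + k)³ = F(G) + 3k M₁(G) + 3k² Σ_b d(b) + n k³,
-- where Σ_b d(b) = 2m by the handshake lemma.  The stated formula is then
-- a polynomial identity in p, p-1, n, F(G), M₁(G) and m.

open import Defs
open import Data.Nat using (ℕ; zero; suc; _+_; _*_; _∸_; _^_; _<?_)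
open import Data.Nat.Properties
  using (+-*-semiring; +-commutativeSemigroup; +-assoc; +-identityʳ; *-identityʳ;
         <-asym; ≤-antisym; ≮⇒≥)
open import Data.Nat.Solver using (module +-*-Solver)
import Data.Nat.ListAction as List
open import Data.Bool using (Bool; true; false; if_then_else_; _∧_)
open import Data.Fin using (Fin; zero; suc; toℕ; combine; _↑ˡ_; _↑ʳ_; _≟_)
open import Data.Fin.Properties using (remQuot-combine; toℕ-injective)
open import Data.List using (map; tabulate)
open import Data.Product using (_,_)
open import Data.Empty using (⊥-elim)
open import Relation.Nullary using (yes; no; does)
open import Relation.Nullary.Decidable using (⌊_⌋)
open import Relation.Binary.PropositionalEquality
  using (_≡_; refl; sym; trans; cong; cong₂; module ≡-Reasoning)
open import Algebra.Properties.Semiring.Sum +-*-semiring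
  using (sum; sum-syntax; sum-cong-≗; ∑-distrib-+; ∑-comm; *-distribˡ-sum)
open import Algebra.Properties.CommutativeSemigroup +-commutativeSemigroup
  using (x∙yz≈y∙xz)

open ≡-Reasoning

-- The list-based vertex sum Σv of the definitions is the library's
-- vector sum; this lets us use the library's summation lemmas.
sum-map-tabulate : ∀ n {m} (f : Fin m → ℕ) (g : Fin n → Fin m) →
                   List.sum (map f (tabulate g)) ≡ ∑[ i < n ] f (g i)
sum-map-tabulate zero    f g = refl
sum-map-tabulate (suc n) f g = cong (f (g zero) +_) (sum-map-tabulate n f (λ i → g (suc i)))

Σv≡∑ : ∀ {n} (f : Fin n → ℕ) → Σv f ≡ ∑[ i < n ] f i
Σv≡∑ {n} f = sum-map-tabulate n f (λ i → i)

sum-const : ∀ n c → ∑[ i < n ] c ≡ n * c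
sum-const zero    c = refl
sum-const (suc n) c = cong (c +_) (sum-const n c)

sum-↑ : ∀ n {k} (f : Fin (n + k) → ℕ) →
        sum f ≡ ∑[ i < n ] f (i ↑ˡ k) + ∑[ j < k ] f (n ↑ʳ j)
sum-↑ zero    f = refl
sum-↑ (suc n) f = trans (cong (f zero +_) (sum-↑ n (λ i → f (suc i))))
                        (sym (+-assoc (f zero) _ _))

sum-combine : ∀ m {n} (f : Fin (m * n) → ℕ) →
              sum f ≡ ∑[ a < m ] ∑[ b < n ] f (combine a b)
sum-combine zero    f = refl
sum-combine (suc m) {n} f =
  trans (sum-↑ n f) (cong (∑[ b < n ] f (b ↑ˡ (m * n)) +_) (sum-combine m (λ i → f (n ↑ʳ i))))

sum-select : ∀ {q} (a : Fin (suc q)) (x y : ℕ) →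
             ∑[ c < suc q ] (if does (a ≟ c) then x else y) ≡ x + q * y
sum-select {q}     zero    x y = cong (x +_) (sum-const q y)
sum-select {suc q} (suc a) x y =
  trans (cong (y +_) (sum-select {q} a x y)) (x∙yz≈y∙xz y x (q * y))

cube : ℕ → ℕ
cube d = d * d * d

cube-+ : ∀ d k → cube (d + k) ≡ cube d + 3 * k * (d * d) + 3 * (k * k) * d + cube k
cube-+ = solve 2 (λ d k → (d :+ k) :* (d :+ k) :* (d :+ k)
                        := d :* d :* d :+ con 3 :* k :* (d :* d) :+ con 3 :* (k :* k) :* d
                           :+ k :* k :* k) refl
  where open +-*-Solver

sum-cube-shift : ∀ n (d : Fin n → ℕ) k →
  ∑[ b < n ] cube (d b + k)
    ≡ ∑[ b < n ] cube (d b) + 3 * k * ∑[ b < n ] (d b * d b)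
      + 3 * (k * k) * ∑[ b < n ] d b + n * cube k
sum-cube-shift n d k = begin
  ∑[ b < n ] cube (d b + k)
    ≡⟨ sum-cong-≗ (λ b → cube-+ (d b) k) ⟩
  ∑[ b < n ] (cube (d b) + 3 * k * (d b * d b) + 3 * (k * k) * d b + cube k)
    ≡⟨ ∑-distrib-+ (λ b → cube (d b) + 3 * k * (d b * d b) + 3 * (k * k) * d b) (λ _ → cube k) ⟩
  ∑[ b < n ] (cube (d b) + 3 * k * (d b * d b) + 3 * (k * k) * d b) + ∑[ b < n ] cube k
    ≡⟨ cong₂ _+_ (∑-distrib-+ (λ b → cube (d b) + 3 * k * (d b * d b)) (λ b → 3 * (k * k) * d b))
                 (sum-const n (cube k)) ⟩
  ∑[ b < n ] (cube (d b) + 3 * k * (d b * d b)) + ∑[ b < n ] (3 * (k * k) * d b) + n * cube k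
    ≡⟨ cong (λ t → t + ∑[ b < n ] (3 * (k * k) * d b) + n * cube k)
            (∑-distrib-+ (λ b → cube (d b)) (λ b → 3 * k * (d b * d b))) ⟩
  ∑[ b < n ] cube (d b) + ∑[ b < n ] (3 * k * (d b * d b)) + ∑[ b < n ] (3 * (k * k) * d b)
    + n * cube k
    ≡⟨ cong₂ (λ s t → ∑[ b < n ] cube (d b) + s + t + n * cube k)
             (sym (*-distribˡ-sum (3 * k) (λ b → d b * d b)))
             (sym (*-distribˡ-sum (3 * (k * k)) d)) ⟩
  ∑[ b < n ] cube (d b) + 3 * k * ∑[ b < n ] (d b * d b) + 3 * (k * k) * ∑[ b < n ] d b
    + n * cube k ∎

degree≡∑ : ∀ {n} (G : Graph n) v → degree G v ≡ ∑[ u < n ] χ (adj G v u)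
degree≡∑ G v = Σv≡∑ (λ u → χ (adj G v u))

orientedEdge : ∀ {n} → Graph n → Fin n → Fin n → ℕ
orientedEdge G u v = χ (⌊ toℕ u <? toℕ v ⌋ ∧ adj G u v)

-- Each adjacency is oriented in exactly one direction (G has no loops).
adjacency-split : ∀ {n} (G : Graph n) u v →
                  χ (adj G u v) ≡ orientedEdge G u v + orientedEdge G v u
adjacency-split G u v with toℕ u <? toℕ v | toℕ v <? toℕ u
... | yes u<v | yes v<u = ⊥-elim (<-asym u<v v<u)
... | yes _   | no  _   = sym (+-identityʳ _)
... | no  _   | yes _   = cong χ (symm G u v)
... | no  u≮v | no  v≮u with toℕ-injective (≤-antisym (≮⇒≥ v≮u) (≮⇒≥ u≮v))
...   | refl rewrite loopless G u = refl

handshake : ∀ {n} (G : Graph n) → ∑[ v < n ] degree G v ≡ 2 * edgeCount G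
handshake {n} G = begin
  ∑[ u < n ] degree G u
    ≡⟨ sum-cong-≗ (λ u → trans (degree≡∑ G u) (sum-cong-≗ (adjacency-split G u))) ⟩
  ∑[ u < n ] ∑[ v < n ] (e u v + e v u)
    ≡⟨ sum-cong-≗ (λ u → ∑-distrib-+ (e u) (λ v → e v u)) ⟩
  ∑[ u < n ] (∑[ v < n ] e u v + ∑[ v < n ] e v u)
    ≡⟨ ∑-distrib-+ (λ u → ∑[ v < n ] e u v) (λ u → ∑[ v < n ] e v u) ⟩
  E + ∑[ u < n ] ∑[ v < n ] e v u
    ≡⟨ cong (E +_) (∑-comm (λ u v → e v u)) ⟩
  E + E
    ≡⟨ cong (E +_) (sym (+-identityʳ E)) ⟩
  2 * E
    ≡⟨ cong (2 *_) edgeCount≡E ⟨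
  2 * edgeCount G ∎
  where
  e : Fin n → Fin n → ℕ
  e = orientedEdge G
  E : ℕ
  E = ∑[ u < n ] ∑[ v < n ] e u v
  edgeCount≡E : edgeCount G ≡ E
  edgeCount≡E = trans (Σv≡∑ (λ u → Σv (e u))) (sum-cong-≗ (λ u → Σv≡∑ (e u)))

joinRule : ∀ {p n} → Graph n → Fin p → Fin p → Fin n → Fin n → Bool
joinRule G a c b d = if does (a ≟ c) then adj G b d else true

joinAdj-rule : ∀ {n} p (G : Graph n) i j →
  joinAdj p G i j ≡ joinRule G (copyOf p i) (copyOf p j) (vertexOf p i) (vertexOf p j)
joinAdj-rule {n} p G i j with copyOf {n} p i ≟ copyOf p j
... | yes _ = refl
... | no  _ = refl

-- Since (a , b) ↦ combine a b inverts (copyOf , vertexOf), adjacency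
-- between combined vertices is given by joinRule.
joinAdj-combine : ∀ {n} p (G : Graph n) (a c : Fin p) (b d : Fin n) →
  joinAdj p G (combine a b) (combine c d) ≡ joinRule G a c b d
joinAdj-combine {n} p G a c b d =
  trans (joinAdj-rule p G (combine a b) (combine c d))
        (cong₂ (λ { (a′ , b′) (c′ , d′) → joinRule G a′ c′ b′ d′ })
               (remQuot-combine {p} {n} a b) (remQuot-combine {p} {n} c d))

neighbours-in-copy : ∀ {p n} (G : Graph n) (a c : Fin p) b →
  ∑[ d < n ] χ (joinRule G a c b d) ≡ (if does (a ≟ c) then degree G b else n)
neighbours-in-copy {n = n} G a c b with does (a ≟ c)
... | true  = sym (degree≡∑ G b)
... | false = trans (sum-const n 1) (*-identityʳ n)

degree-join : ∀ {n} p (G : Graph n) (a : Fin p) b →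
  degree (joinCopies p G) (combine a b) ≡ degree G b + (p ∸ 1) * n
degree-join {n} (suc q) G a b = begin
  degree (joinCopies (suc q) G) (combine a b)
    ≡⟨ degree≡∑ (joinCopies (suc q) G) (combine a b) ⟩
  ∑[ j < suc q * n ] χ (joinAdj (suc q) G (combine a b) j)
    ≡⟨ sum-combine (suc q) (λ j → χ (joinAdj (suc q) G (combine a b) j)) ⟩
  ∑[ c < suc q ] ∑[ d < n ] χ (joinAdj (suc q) G (combine a b) (combine c d))
    ≡⟨ sum-cong-≗ (λ c → sum-cong-≗ (λ d → cong χ (joinAdj-combine (suc q) G a c b d))) ⟩
  ∑[ c < suc q ] ∑[ d < n ] χ (joinRule G a c b d)
    ≡⟨ sum-cong-≗ (λ c → neighbours-in-copy G a c b) ⟩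
  ∑[ c < suc q ] (if does (a ≟ c) then degree G b else n)
    ≡⟨ sum-select a (degree G b) n ⟩
  degree G b + q * n ∎

Findex-join : ∀ {n} p (G : Graph n) →
  Findex (joinCopies p G) ≡ p * ∑[ b < n ] cube (degree G b + (p ∸ 1) * n)
Findex-join {n} p G = begin
  Findex (joinCopies p G)
    ≡⟨ Σv≡∑ (λ i → cube (degree (joinCopies p G) i)) ⟩
  ∑[ i < p * n ] cube (degree (joinCopies p G) i)
    ≡⟨ sum-combine p (λ i → cube (degree (joinCopies p G) i)) ⟩
  ∑[ a < p ] ∑[ b < n ] cube (degree (joinCopies p G) (combine a b))
    ≡⟨ sum-cong-≗ (λ a → sum-cong-≗ (λ b → cong cube (degree-join p G a b))) ⟩
  ∑[ a < p ] ∑[ b < n ] cube (degree G b + (p ∸ 1) * n)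
    ≡⟨ sum-const p _ ⟩
  p * ∑[ b < n ] cube (degree G b + (p ∸ 1) * n) ∎

-- The final rearrangement, with q standing for p - 1.
join-polynomial : ∀ p q n F M m →
  p * (F + 3 * (q * n) * M + 3 * ((q * n) * (q * n)) * (2 * m) + n * cube (q * n))
    ≡ p * F + 3 * n * p * q * M + 6 * n ^ 2 * m * p * q ^ 2 + n ^ 4 * p * q ^ 3
join-polynomial = solve 6 (λ p q n F M m →
    p :* (F :+ con 3 :* (q :* n) :* M :+ con 3 :* ((q :* n) :* (q :* n)) :* (con 2 :* m)
          :+ n :* ((q :* n) :* (q :* n) :* (q :* n)))
  := p :* F :+ con 3 :* n :* p :* q :* M :+ con 6 :* n :^ 2 :* m :* p :* q :^ 2
     :+ n :^ 4 :* p :* q :^ 3) refl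
  where open +-*-Solver

corollary1 : (n : ℕ) (G : Graph n) → Connected G → (p : ℕ) →
    Findex (joinCopies p G)
      ≡ p * Findex G + 3 * n * p * (p ∸ 1) * M₁ G
        + 6 * n ^ 2 * edgeCount G * p * (p ∸ 1) ^ 2
        + n ^ 4 * p * (p ∸ 1) ^ 3
corollary1 n G _ p = begin
  Findex (joinCopies p G)
    ≡⟨ Findex-join p G ⟩
  p * ∑[ b < n ] cube (d b + k)
    ≡⟨ cong (p *_) (sum-cube-shift n d k) ⟩
  p * (∑[ b < n ] cube (d b) + 3 * k * ∑[ b < n ] (d b * d b)
       + 3 * (k * k) * ∑[ b < n ] d b + n * cube k)
    ≡⟨ cong (λ { (F , M , D) → p * (F + 3 * k * M + 3 * (k * k) * D + n * cube k) })
            (cong₂ _,_ (sym (Σv≡∑ (λ b → cube (d b))))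
                   (cong₂ _,_ (sym (Σv≡∑ (λ b → d b * d b))) (handshake G))) ⟩
  p * (Findex G + 3 * k * M₁ G + 3 * (k * k) * (2 * edgeCount G) + n * cube k)
    ≡⟨ join-polynomial p (p ∸ 1) n (Findex G) (M₁ G) (edgeCount G) ⟩
  p * Findex G + 3 * n * p * (p ∸ 1) * M₁ G + 6 * n ^ 2 * edgeCount G * p * (p ∸ 1) ^ 2
    + n ^ 4 * p * (p ∸ 1) ^ 3 ∎
  where
  d : Fin n → ℕ
  d = degree G
  k : ℕ
  k = (p ∸ 1) * n
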